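{- The set of idempotent elements of $\mathrm{PT}$ coincides with $E$. Moreover, for all $d,e\in E$, $de=d\cup e$ (the element of $E$ whose skeleton is the union of the skeletons of $d$ and $e$); consequently any two idempotents of $\mathrm{PT}$ commute.
   Context: A tree is a nonempty prefix-closed finitely branching set $A\subseteq(\mathbb N^+)^*$ with $wj\in A$, $i<j$ implying $wi\in A$. A permutation tree is a map $t:A\to\mathrm{Sym}(\mathbb N^+)$ (possibly infinite; $A$ is its skeleton) such that a node with exactly $n$ children has label in $S_n$ (permutations of $\mathbb N^+$ fixing all $i>n$). Write $t=\langle\pi;t_1,..,t_n\rangle$; $\bar\epsilon$ is the one-node tree; $\iota$ is the identity. $\mathrm{PT}$ is the set of permutation trees with product (coinductive): $t\bar\epsilon=t=\bar\epsilon t$; for $t=\langle\pi;t_1..t_n\rangle$, $u=\langle\rho;u_1..u_m\rangle$: if $n\ge m$, $tu=\langle\pi\circ\rho;u_1t_{\rho1},..,u_mt_{\rho m},t_{m+1},..,t_n\rangle$; if $m\ge n$, $tu=\langle\pi\circ\rho;u_1t_{\rho1},..,u_mt_{\rho m}\rangle$ with $t_j:=\bar\epsilon$ for $j>n$. $E\subseteq\mathrm{PT}$ is the greatest set such that every $t\in E$ is of the form $\langle\iota;t_1,..,t_n\rangle$ with $t_i\in E$, i.e. the permutation trees all of whose labels are $\iota$; such trees are identified with their skeletons. -}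

module Defs where

open import Data.Nat using (ℕ; zero; suc; _≤_; _<_; _⊔_; _<?_)
open import Data.Nat.Properties using (≤-trans; m≤m⊔n; m≤n⊔m)
open import Data.List using (List; []; _∷_)
open import Data.Unit using (⊤)
open import Data.Product using (_×_; _,_)
open import Relation.Nullary using (yes; no)
open import Relation.Binary.PropositionalEquality using (_≡_; refl; trans; cong)
open import Function.Bundles using (_↔_; _⇔_; Inverse)
open import Function.Construct.Identity using (↔-id)
open import Function.Construct.Composition using (_↔-∘_)

-- Conventions: positions/children are 0-based, so ℕ plays the role of ℕ⁺
-- (index k here corresponds to k+1 in the paper).  Sym(ℕ) = bijections ℕ ↔ ℕ.

Sym : Set
Sym = ℕ ↔ ℕ

_⟨$⟩_ : Sym → ℕ → ℕ
π ⟨$⟩ k = Inverse.to π k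

ι : Sym
ι = ↔-id ℕ

-- composition π ∘ ρ  (apply ρ first)
_∘ₚ_ : Sym → Sym → Sym
π ∘ₚ ρ = π ↔-∘ ρ

-- A (possibly infinite) permutation tree, given node-wise (addresses are lists,
-- the root is []).  `arity w` is the number of children of node w; the skeleton
-- is the set of addresses k₁ ∷ … ∷ kₗ ∷ [] with each kⱼ below the arity of the
-- preceding node (hence automatically nonempty, prefix closed, finitely branching,
-- and closed under smaller siblings).  `label w` is the label of node w, which
-- lies in S_(arity w) (fixes every k ≥ arity w).  Values of `arity`/`label`
-- outside the skeleton are irrelevant (see _≈_).
record PT : Set where
  field
    arity : List ℕ → ℕ
    label : List ℕ → Sym
    fixes : ∀ w k → arity w ≤ k → label w ⟨$⟩ k ≡ k
open PT public

ε̄ : PT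
arity ε̄ _ = 0
label ε̄ _ = ι
fixes ε̄ _ _ _ = refl

-- the k-th subtree t_k, with the convention t_k := ε̄ for k beyond the arity
sub : PT → ℕ → PT
sub t k with k <? arity t []
... | yes _ = record { arity = λ w → arity t (k ∷ w)
                     ; label = λ w → label t (k ∷ w)
                     ; fixes = λ w → fixes t (k ∷ w) }
... | no  _ = ε̄

_∈ₛ_ : List ℕ → PT → Set
[] ∈ₛ t = ⊤
(k ∷ w) ∈ₛ t = (k < arity t []) × (w ∈ₛ sub t k)

-- The product t u (the paper's coinductive definition, unfolded node-wise by
-- recursion on the address):  root label π ∘ ρ, root arity max(n,m), child i is
-- u_i t_{ρ i} for i < m (m = arity of u) and t_i for m ≤ i.
prodArity : PT → PT → List ℕ → ℕ
prodArity t u [] = arity t [] ⊔ arity u []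
prodArity t u (i ∷ w) with i <? arity u []
... | yes _ = prodArity (sub u i) (sub t (label u [] ⟨$⟩ i)) w
... | no  _ = arity (sub t i) w

prodLabel : PT → PT → List ℕ → Sym
prodLabel t u [] = label t [] ∘ₚ label u []
prodLabel t u (i ∷ w) with i <? arity u []
... | yes _ = prodLabel (sub u i) (sub t (label u [] ⟨$⟩ i)) w
... | no  _ = label (sub t i) w

prodFixes : ∀ t u w k → prodArity t u w ≤ k → prodLabel t u w ⟨$⟩ k ≡ k
prodFixes t u [] k h =
  trans (cong (label t [] ⟨$⟩_) (fixes u [] k (≤-trans (m≤n⊔m (arity t []) (arity u [])) h)))
        (fixes t [] k (≤-trans (m≤m⊔n (arity t []) (arity u [])) h))
prodFixes t u (i ∷ w) k h with i <? arity u []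
... | yes _ = prodFixes (sub u i) (sub t (label u [] ⟨$⟩ i)) w k h
... | no  _ = fixes (sub t i) w k h

_·_ : PT → PT → PT
t · u = record { arity = prodArity t u ; label = prodLabel t u ; fixes = prodFixes t u }

_≈_ : PT → PT → Set
t ≈ u = ∀ w → (w ∈ₛ t ⇔ w ∈ₛ u)
              × (w ∈ₛ t → ∀ k → label t w ⟨$⟩ k ≡ label u w ⟨$⟩ k)

InE : PT → Set
InE t = ∀ w → w ∈ₛ t → ∀ k → label t w ⟨$⟩ k ≡ k

Idempotent : PT → Set
Idempotent t = (t · t) ≈ t

unionArity : PT → PT → List ℕ → ℕ
unionArity d e [] = arity d [] ⊔ arity e []
unionArity d e (k ∷ w) = unionArity (sub d k) (sub e k) w

_∪_ : PT → PT → PT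
d ∪ e = record { arity = unionArity d e ; label = λ _ → ι ; fixes = λ _ _ _ → refl }

module Submission where

open import Defs
open import Data.Product using (_×_)
open import Function.Bundles using (_⇔_)

open import Data.Nat using (ℕ; _≤_; _<_; _≮_; _<?_)
open import Data.Nat.Properties
  using (≤-antisym; ≮⇒≥; <-irrefl; <-≤-trans; m≤n⊔m; ⊔-comm; ⊔-idem; ⊔-identityʳ)
open import Data.List using (List; []; _∷_)
open import Data.Unit using (tt)
open import Data.Product using (_,_; proj₁; proj₂)
open import Relation.Nullary using (yes; no)
open import Relation.Nullary.Negation using (contradiction)
open import Relation.Binary.Bundles using (Setoid)
open import Relation.Binary.PropositionalEquality
  using (_≡_; refl; sym; trans; cong; subst; subst₂)
open import Function.Bundles using (mk⇔; Equivalence; Injection)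
open import Function.Properties.Inverse using (↔⇒↣)
import Relation.Binary.Reasoning.Setoid as SetoidReasoning

-- An idempotent t = ⟨π; t₁, …, tₙ⟩ has π ∘ π = π, so π = ι; then the i-th child of t t
-- is tᵢ tᵢ, so every subtree of t is idempotent and all labels of t are ι.  For d, e ∈ E
-- the children of d e are eᵢ dᵢ (or dᵢ ε̄ = dᵢ beyond the arity of e), again products of
-- elements of E, so d e and d ∪ e are bisimilar.  With d ∪ d = d this makes every element
-- of E idempotent, and commutativity of ∪ makes idempotents commute.

-- The value of `sub t k` below the arity, without the decision `k <? arity t []` that
-- blocks its computation.
child : PT → ℕ → PT
child t k = record
  { arity = λ w → arity t (k ∷ w)
  ; label = λ w → label t (k ∷ w)
  ; fixes = λ w → fixes t (k ∷ w)
  }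

sub-below : ∀ t {k} → k < arity t [] → sub t k ≡ child t k
sub-below t {k} k<n with k <? arity t []
... | yes _   = refl
... | no  k≮n = contradiction k<n k≮n

sub-beyond : ∀ t {k} → k ≮ arity t [] → sub t k ≡ ε̄
sub-beyond t {k} k≮n with k <? arity t []
... | yes k<n = contradiction k<n k≮n
... | no  _   = refl

label-sub : ∀ t {k} → k < arity t [] → ∀ w → label (sub t k) w ≡ label t (k ∷ w)
label-sub t k<n w = cong (λ s → label s w) (sub-below t k<n)

Agree : PT → PT → List ℕ → Set
Agree t u w = (w ∈ₛ t ⇔ w ∈ₛ u) × (w ∈ₛ t → ∀ x → label t w ⟨$⟩ x ≡ label u w ⟨$⟩ x)

agree-sym : ∀ {t u w} → Agree t u w → Agree u t w
agree-sym (t⇔u , t≡u) = mk⇔ from to , λ m x → sym (t≡u (from m) x)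
  where open Equivalence t⇔u

agree-trans : ∀ {t u v w} → Agree t u w → Agree u v w → Agree t v w
agree-trans (t⇔u , t≡u) (u⇔v , u≡v) =
  mk⇔ (λ m → to u⇔v (to t⇔u m)) (λ m → from t⇔u (from u⇔v m)) ,
  λ m x → trans (t≡u m x) (u≡v (to t⇔u m) x)
  where open Equivalence

agree-∷ : ∀ {t u k w} → arity t [] ≡ arity u [] →
          (k < arity t [] → Agree (sub t k) (sub u k) w) → Agree t u (k ∷ w)
agree-∷ {t} {u} {k} {w} n≡m agree-children =
  mk⇔ (λ { (k<n , m) → k<m k<n , to (proj₁ (agree-children k<n)) m })
      (λ { (k<m , m) → k<n k<m , from (proj₁ (agree-children (k<n k<m))) m }) ,
  λ { (k<n , m) x → trans (cong (_⟨$⟩ x) (sym (label-sub t k<n w)))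
                      (trans (proj₂ (agree-children k<n) m x)
                             (cong (_⟨$⟩ x) (label-sub u (k<m k<n) w))) }
  where
  open Equivalence
  k<m : k < arity t [] → k < arity u []
  k<m = subst (k <_) n≡m
  k<n : k < arity u [] → k < arity t []
  k<n = subst (k <_) (sym n≡m)

≈-refl : ∀ {t} → t ≈ t
≈-refl w = mk⇔ (λ m → m) (λ m → m) , λ _ _ → refl

≈-sym : ∀ {t u} → t ≈ u → u ≈ t
≈-sym t≈u w = agree-sym (t≈u w)

≈-trans : ∀ {t u v} → t ≈ u → u ≈ v → t ≈ v
≈-trans t≈u u≈v w = agree-trans (t≈u w) (u≈v w)

≈-setoid : Setoid _ _
≈-setoid = record
  { Carrier       = PT
  ; _≈_           = _≈_
  ; isEquivalence = record { refl = ≈-refl ; sym = ≈-sym ; trans = ≈-trans }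
  }

module ≈-Reasoning = SetoidReasoning ≈-setoid

≈-arity-root : ∀ {t u} → t ≈ u → arity t [] ≡ arity u []
≈-arity-root t≈u = ≤-antisym (≈⇒arity-root-≤ t≈u) (≈⇒arity-root-≤ (≈-sym t≈u))
  where
  ≈⇒arity-root-≤ : ∀ {t u} → t ≈ u → arity t [] ≤ arity u []
  ≈⇒arity-root-≤ {t} {u} t≈u = ≮⇒≥ λ m<n →
    <-irrefl refl (proj₁ (Equivalence.to (proj₁ (t≈u (arity u [] ∷ []))) (m<n , tt)))

≈-sub : ∀ {t u k} → t ≈ u → k < arity t [] → sub t k ≈ sub u k
≈-sub {t} {u} {k} t≈u k<n w =
  mk⇔ (λ m → proj₂ (to (k<n , m))) (λ m → proj₂ (from (k<m , m))) ,
  λ m x → trans (cong (_⟨$⟩ x) (label-sub t k<n w))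
            (trans (proj₂ (t≈u (k ∷ w)) (k<n , m) x)
                   (cong (_⟨$⟩ x) (sym (label-sub u k<m w))))
  where
  open Equivalence (proj₁ (t≈u (k ∷ w)))
  k<m : k < arity u []
  k<m = subst (k <_) (≈-arity-root t≈u) k<n

data UpTo≈ (R : PT → PT → Set) (t u : PT) : Set where
  equal   : t ≈ u → UpTo≈ R t u
  related : ∀ {t′ u′} → t ≈ t′ → R t′ u′ → u′ ≈ u → UpTo≈ R t u

record IsBisimulation (R : PT → PT → Set) : Set₁ where
  field
    arity-root  : ∀ {t u} → R t u → arity t [] ≡ arity u []
    label-root  : ∀ {t u} → R t u → ∀ x → label t [] ⟨$⟩ x ≡ label u [] ⟨$⟩ x
    related-sub : ∀ {t u} → R t u → ∀ {k} → k < arity t [] → UpTo≈ R (sub t k) (sub u k)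

module _ {R : PT → PT → Set} (isBisimulation : IsBisimulation R) where
  open IsBisimulation isBisimulation

  bisimilar-agree : ∀ w {t u} → R t u → Agree t u w
  bisimilar-agree []      r = mk⇔ (λ _ → tt) (λ _ → tt) , λ _ → label-root r
  bisimilar-agree (k ∷ w) {t} {u} r =
    agree-∷ {t} {u} (arity-root r) (λ k<n → agree-upTo (related-sub r k<n))
    where
    agree-upTo : ∀ {t u} → UpTo≈ R t u → Agree t u w
    agree-upTo (equal t≈u)           = t≈u w
    agree-upTo (related t≈t′ r′ u′≈u) =
      agree-trans (t≈t′ w) (agree-trans (bisimilar-agree w r′) (u′≈u w))

  bisimulation⇒≈ : ∀ {t u} → R t u → t ≈ u
  bisimulation⇒≈ r w = bisimilar-agree w r

_≐_ : PT → PT → Set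
t ≐ u = (∀ w → arity t w ≡ arity u w) × (∀ w → label t w ≡ label u w)

≐-sub : ∀ {t u} → t ≐ u → ∀ {k} → k < arity t [] → sub t k ≐ sub u k
≐-sub {t} {u} t≐u {k} k<n =
  subst₂ _≐_ (sym (sub-below t k<n)) (sym (sub-below u (subst (k <_) (proj₁ t≐u []) k<n)))
    children≐
  where
  children≐ : child t k ≐ child u k
  children≐ = (λ w → proj₁ t≐u (k ∷ w)) , (λ w → proj₂ t≐u (k ∷ w))

≐-isBisimulation : IsBisimulation _≐_
≐-isBisimulation = record
  { arity-root  = λ t≐u → proj₁ t≐u []
  ; label-root  = λ t≐u x → cong (_⟨$⟩ x) (proj₂ t≐u [])
  ; related-sub = λ t≐u k<n → related ≈-refl (≐-sub t≐u k<n) ≈-refl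
  }

≐⇒≈ : ∀ {t u} → t ≐ u → t ≈ u
≐⇒≈ = bisimulation⇒≈ ≐-isBisimulation

sub-≈ : ∀ t {k s} → k < arity t [] → child t k ≐ s → sub t k ≈ s
sub-≈ t {s = s} k<n child≐s = ≐⇒≈ (subst (_≐ s) (sym (sub-below t k<n)) child≐s)

prodArity-below : ∀ t u {k} → k < arity u [] → ∀ w →
  prodArity t u (k ∷ w) ≡ prodArity (sub u k) (sub t (label u [] ⟨$⟩ k)) w
prodArity-below t u {k} k<m w with k <? arity u []
... | yes k<m′ = cong (λ s → prodArity s (sub t (label u [] ⟨$⟩ k)) w) (sub-below u k<m′)
... | no  k≮m  = contradiction k<m k≮m

prodLabel-below : ∀ t u {k} → k < arity u [] → ∀ w →
  prodLabel t u (k ∷ w) ≡ prodLabel (sub u k) (sub t (label u [] ⟨$⟩ k)) w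
prodLabel-below t u {k} k<m w with k <? arity u []
... | yes k<m′ = cong (λ s → prodLabel s (sub t (label u [] ⟨$⟩ k)) w) (sub-below u k<m′)
... | no  k≮m  = contradiction k<m k≮m

prodArity-beyond : ∀ t u {k} → k ≮ arity u [] → ∀ w → prodArity t u (k ∷ w) ≡ arity (sub t k) w
prodArity-beyond t u {k} k≮m w with k <? arity u []
... | yes k<m = contradiction k<m k≮m
... | no  _   = refl

prodLabel-beyond : ∀ t u {k} → k ≮ arity u [] → ∀ w → prodLabel t u (k ∷ w) ≡ label (sub t k) w
prodLabel-beyond t u {k} k≮m w with k <? arity u []
... | yes k<m = contradiction k<m k≮m
... | no  _   = refl

sub-·-below : ∀ t u {k} → k < arity u [] → sub (t · u) k ≈ (sub u k · sub t (label u [] ⟨$⟩ k))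
sub-·-below t u k<m =
  sub-≈ (t · u) (<-≤-trans k<m (m≤n⊔m (arity t []) (arity u [])))
    (prodArity-below t u k<m , prodLabel-below t u k<m)

sub-·-beyond : ∀ t u {k} → k < arity (t · u) [] → k ≮ arity u [] → sub (t · u) k ≈ sub t k
sub-·-beyond t u k<n k≮m =
  sub-≈ (t · u) k<n (prodArity-beyond t u k≮m , prodLabel-beyond t u k≮m)

data RightUnit : PT → PT → Set where
  right-unit : ∀ t → RightUnit (t · ε̄) t

rightUnit-isBisimulation : IsBisimulation RightUnit
rightUnit-isBisimulation = record
  { arity-root  = λ { (right-unit t) → ⊔-identityʳ (arity t []) }
  ; label-root  = λ { (right-unit t) x → refl }
  ; related-sub = λ { (right-unit t) k<n → equal (sub-·-beyond t ε̄ k<n λ ()) }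
  }

·-identityʳ : ∀ t → (t · ε̄) ≈ t
·-identityʳ t = bisimulation⇒≈ rightUnit-isBisimulation (right-unit t)

unionArity-comm : ∀ d e w → unionArity d e w ≡ unionArity e d w
unionArity-comm d e []      = ⊔-comm (arity d []) (arity e [])
unionArity-comm d e (k ∷ w) = unionArity-comm (sub d k) (sub e k) w

∪-comm : ∀ d e → (d ∪ e) ≈ (e ∪ d)
∪-comm d e = ≐⇒≈ (unionArity-comm d e , λ _ → refl)

sub-∪ : ∀ d e {k} → k < arity (d ∪ e) [] → sub (d ∪ e) k ≈ (sub d k ∪ sub e k)
sub-∪ d e k<n = sub-≈ (d ∪ e) k<n ((λ _ → refl) , (λ _ → refl))

InE-sub : ∀ {t} → InE t → ∀ k → InE (sub t k)
InE-sub {t} t∈E k with k <? arity t []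
... | yes k<n = λ w m → t∈E (k ∷ w) (k<n , subst (w ∈ₛ_) (sym (sub-below t k<n)) m)
... | no  _   = λ _ _ _ → refl

data ProductInE : PT → PT → Set where
  product : ∀ {d e} → InE d → InE e → ProductInE (d · e) (d ∪ e)

productInE-isBisimulation : IsBisimulation ProductInE
productInE-isBisimulation = record
  { arity-root  = λ { (product _ _) → refl }
  ; label-root  = λ { (product {d} d∈E e∈E) x →
                      trans (cong (label d [] ⟨$⟩_) (e∈E [] tt x)) (d∈E [] tt x) }
  ; related-sub = related-sub
  }
  where
  open ≈-Reasoning
  related-sub : ∀ {t u} → ProductInE t u → ∀ {k} → k < arity t [] →
                UpTo≈ ProductInE (sub t k) (sub u k)
  related-sub (product {d} {e} d∈E e∈E) {k} k<n with k <? arity e []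
  ... | yes k<m = related
    (begin
      sub (d · e) k                             ≈⟨ sub-·-below d e k<m ⟩
      sub e k · sub d (label e [] ⟨$⟩ k)        ≡⟨ cong (λ j → sub e k · sub d j) (e∈E [] tt k) ⟩
      sub e k · sub d k                         ∎)
    (product (InE-sub e∈E k) (InE-sub d∈E k))
    (≈-trans (∪-comm (sub e k) (sub d k)) (≈-sym (sub-∪ d e k<n)))
  ... | no k≮m = related
    (begin
      sub (d · e) k      ≈⟨ sub-·-beyond d e k<n k≮m ⟩
      sub d k            ≈⟨ ·-identityʳ (sub d k) ⟨
      sub d k · ε̄        ≡⟨ cong (sub d k ·_) (sym (sub-beyond e k≮m)) ⟩
      sub d k · sub e k  ∎)
    (product (InE-sub d∈E k) (InE-sub e∈E k))
    (≈-sym (sub-∪ d e k<n))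

InE-·≈∪ : (d e : PT) → InE d → InE e → (d · e) ≈ (d ∪ e)
InE-·≈∪ d e d∈E e∈E = bisimulation⇒≈ productInE-isBisimulation (product d∈E e∈E)

data SelfUnionInE : PT → PT → Set where
  self-union : ∀ {d} → InE d → SelfUnionInE (d ∪ d) d

selfUnionInE-isBisimulation : IsBisimulation SelfUnionInE
selfUnionInE-isBisimulation = record
  { arity-root  = λ { (self-union {d} _) → ⊔-idem (arity d []) }
  ; label-root  = λ { (self-union d∈E) x → sym (d∈E [] tt x) }
  ; related-sub = λ { (self-union {d} d∈E) {k} k<n →
                      related (sub-∪ d d k<n) (self-union (InE-sub d∈E k)) ≈-refl }
  }

InE-∪-idem : ∀ {d} → InE d → (d ∪ d) ≈ d
InE-∪-idem d∈E = bisimulation⇒≈ selfUnionInE-isBisimulation (self-union d∈E)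

InE⇒Idempotent : ∀ {t} → InE t → Idempotent t
InE⇒Idempotent {t} t∈E = ≈-trans (InE-·≈∪ t t t∈E t∈E) (InE-∪-idem t∈E)

idempotent-permutation-is-identity : (π : Sym) → (∀ x → π ⟨$⟩ (π ⟨$⟩ x) ≡ π ⟨$⟩ x) →
                                     ∀ x → π ⟨$⟩ x ≡ x
idempotent-permutation-is-identity π ππ≡π x = Injection.injective (↔⇒↣ π) (ππ≡π x)

Idempotent⇒root-ι : ∀ {t} → Idempotent t → ∀ x → label t [] ⟨$⟩ x ≡ x
Idempotent⇒root-ι {t} t·t≈t =
  idempotent-permutation-is-identity (label t []) (proj₂ (t·t≈t []) tt)

Idempotent-sub : ∀ {t k} → Idempotent t → k < arity t [] → Idempotent (sub t k)
Idempotent-sub {t} {k} t·t≈t k<n =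
  begin
    sub t k · sub t k                   ≡⟨ cong (λ j → sub t k · sub t j) (root-ι k) ⟨
    sub t k · sub t (label t [] ⟨$⟩ k)  ≈⟨ sub-·-below t t k<n ⟨
    sub (t · t) k                       ≈⟨ ≈-sub t·t≈t k<arity-t·t ⟩
    sub t k                             ∎
  where
  open ≈-Reasoning
  root-ι : ∀ x → label t [] ⟨$⟩ x ≡ x
  root-ι = Idempotent⇒root-ι t·t≈t
  k<arity-t·t : k < arity (t · t) []
  k<arity-t·t = <-≤-trans k<n (m≤n⊔m (arity t []) (arity t []))

Idempotent⇒InE : ∀ {t} → Idempotent t → InE t
Idempotent⇒InE t·t≈t []      _          = Idempotent⇒root-ι t·t≈t
Idempotent⇒InE {t} t·t≈t (k ∷ w) (k<n , m) x =
  trans (cong (_⟨$⟩ x) (sym (label-sub t k<n w)))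
        (Idempotent⇒InE (Idempotent-sub t·t≈t k<n) w m x)

idempotents-commute : (s t : PT) → Idempotent s → Idempotent t → (s · t) ≈ (t · s)
idempotents-commute s t s·s≈s t·t≈t =
  begin
    s · t  ≈⟨ InE-·≈∪ s t s∈E t∈E ⟩
    s ∪ t  ≈⟨ ∪-comm s t ⟩
    t ∪ s  ≈⟨ InE-·≈∪ t s t∈E s∈E ⟨
    t · s  ∎
  where
  open ≈-Reasoning
  s∈E : InE s
  s∈E = Idempotent⇒InE s·s≈s
  t∈E : InE t
  t∈E = Idempotent⇒InE t·t≈t

proposition3p5 : ((t : PT) → Idempotent t ⇔ InE t)
                 × ((d e : PT) → InE d → InE e → (d · e) ≈ (d ∪ e))
                 × ((s t : PT) → Idempotent s → Idempotent t → (s · t) ≈ (t · s))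
proposition3p5 = (λ t → mk⇔ Idempotent⇒InE InE⇒Idempotent) , InE-·≈∪ , idempotents-commute
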